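{- Let $(P_n)_{n\in\mathbb{Z}}$ be the Padovan sequence. Let $a,b,m$ be integers with $m\ge 0$ and $1\le b\le a<n$, where $n=am+b$. Then for every integer $j\ge 0$ there exist integers $c_1,c_2,c_3$ such that $$P_n=c_1P_{a(j+2)+b}+c_2P_{a(j+1)+b}+c_3P_{aj+b};$$ in particular (taking $j=0$), $P_n$ is an integer linear combination of $P_{2a+b}$, $P_{a+b}$ and $P_b$.
   Context: The Padovan numbers are defined by $P_0=P_1=P_2=1$ and $P_{n+3}=P_{n+1}+P_n$ for $n\ge 0$; the sequence is extended to all integers $n$ by the recurrence read backwards, $P_n=P_{n+3}-P_{n+1}$. (In the "$a$ columns Padovan table", where $P_1,P_2,\dots$ are written row by row in rows of length $a$, the numbers $P_{aj+b}$, $j=0,1,2,\dots$, are the entries of the $b$th column.) -}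

module Defs where

open import Data.Nat using (ℕ; zero; suc)
open import Data.Integer using (ℤ; +_; -[1+_]; _+_; _-_)
open import Data.Product using (_×_; _,_)

padℕ : ℕ → ℤ
padℕ 0 = + 1
padℕ 1 = + 1
padℕ 2 = + 1
padℕ (suc (suc (suc n))) = padℕ (suc n) + padℕ n

-- triple k = (P(-k), P(-k+1), P(-k+2)), computed by the backward recursion
-- P(i) = P(i+3) - P(i+1).
triple : ℕ → ℤ × ℤ × ℤ
triple zero = padℕ 0 , padℕ 1 , padℕ 2
triple (suc k) with triple k
... | (x0 , x1 , x2) = (x2 - x0) , x0 , x1

P : ℤ → ℤ
P (+ n) = padℕ n
P -[1+ k ] with triple (suc k)
... | (x , _ , _) = x

-- For every step a, the vector window n = (P n, P (n+1), P (n+2)) is carried to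
-- window (n + a) by a fixed integer matrix T.  By Cayley–Hamilton the subsequence
-- k ↦ P (x + a k) therefore obeys a three-term recurrence with integer coefficients,
-- and, using the matrix for the step -a, also one running backwards.  Propagating in
-- both directions from k = 0, 1, 2 shows that every term is an integer combination
-- of P x, P (x + a) and P (x + 2a).

module Submission where

open import Defs
open import Data.Nat using (zero; suc)
import Data.Nat.Properties as ℕ
open import Data.Integer hiding (suc)
open import Data.Integer.Properties using (+-assoc; +-identityʳ)
open import Data.Integer.Tactic.RingSolver using (solve-∀; solve)
open import Data.List using ([]; _∷_)
open import Data.Product using (∃; _×_; _,_; proj₁; proj₂)
open import Data.Unit using (⊤; tt)
open import Function using (_∘_)
open import Relation.Binary.PropositionalEquality
open ≡-Reasoning

P-rec : ∀ n → P (n + + 3) ≡ P (n + + 1) + P n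
P-rec (+ n) rewrite ℕ.+-comm n 3 | ℕ.+-comm n 1 = refl
P-rec -[1+ 0 ] = refl
P-rec -[1+ 1 ] = refl
P-rec -[1+ 2 ] = refl
-- Defs computes P at negative arguments by P i = P (i + 3) - P (i + 1).
P-rec -[1+ suc (suc (suc k)) ] = x≡y+[x-y] (proj₁ (triple (suc k))) (proj₁ (triple (suc (suc (suc k)))))
  where
  x≡y+[x-y] : ∀ x y → x ≡ y + (x - y)
  x≡y+[x-y] = solve-∀

ℤ-ind : ∀ {ℓ} (Q : ℤ → Set ℓ) → Q (+ 0) →
        (∀ e → Q e → Q (e + + 1)) → (∀ e → Q (e + + 1) → Q e) → ∀ e → Q e
ℤ-ind Q q₀ up down (+ zero) = q₀
ℤ-ind Q q₀ up down (+ suc n) =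
  subst Q (cong +_ (ℕ.+-comm n 1)) (up (+ n) (ℤ-ind Q q₀ up down (+ n)))
ℤ-ind Q q₀ up down -[1+ zero ] = down -[1+ zero ] q₀
ℤ-ind Q q₀ up down -[1+ suc n ] = down -[1+ suc n ] (ℤ-ind Q q₀ up down -[1+ n ])

ℤ-ind₃ : ∀ {ℓ} (Q : ℤ → Set ℓ) → Q (+ 0) → Q (+ 1) → Q (+ 2) →
         (∀ e → Q e → Q (e + + 1) → Q (e + + 2) → Q (e + + 3)) →
         (∀ e → Q (e + + 1) → Q (e + + 2) → Q (e + + 3) → Q e) → ∀ e → Q e
ℤ-ind₃ Q q₀ q₁ q₂ up down = proj₁ ∘ ℤ-ind Q₃ (q₀ , q₁ , q₂) up₃ down₃
  where
  Q₃ : ℤ → Set _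
  Q₃ e = Q e × Q (e + + 1) × Q (e + + 2)

  shift : ∀ e {k} → Q (e + + suc k) → Q ((e + + 1) + + k)
  shift e = subst Q (sym (+-assoc e (+ 1) _))

  unshift : ∀ e {k} → Q ((e + + 1) + + k) → Q (e + + suc k)
  unshift e = subst Q (+-assoc e (+ 1) _)

  up₃ : ∀ e → Q₃ e → Q₃ (e + + 1)
  up₃ e (q₀ , q₁ , q₂) = q₁ , shift e q₂ , shift e (up e q₀ q₁ q₂)

  down₃ : ∀ e → Q₃ (e + + 1) → Q₃ e
  down₃ e (q₁ , q₂ , q₃) = down e q₁ q₂′ q₃′ , q₁ , q₂′
    where
    q₂′ : Q (e + + 2)
    q₂′ = unshift e q₂
    q₃′ : Q (e + + 3)
    q₃′ = unshift e q₃

ℤ³ : Set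
ℤ³ = ℤ × ℤ × ℤ

Mat₃ : Set
Mat₃ = ℤ³ × ℤ³ × ℤ³

head : ℤ³ → ℤ
head = proj₁

infix 8 _·_
infixr 8 _⊛_
infixl 6 _⊕_
infixr 7 _∙_

_·_ : ℤ³ → ℤ³ → ℤ
(a , b , c) · (x , y , z) = a * x + b * y + c * z

_⊛_ : Mat₃ → ℤ³ → ℤ³
(r₀ , r₁ , r₂) ⊛ v = r₀ · v , r₁ · v , r₂ · v

_⊕_ : ℤ³ → ℤ³ → ℤ³
(a , b , c) ⊕ (x , y , z) = a + x , b + y , c + z

_∙_ : ℤ → ℤ³ → ℤ³
k ∙ (x , y , z) = k * x , k * y , k * z

·-distribʳ-⊕ : ∀ r s v → (r ⊕ s) · v ≡ r · v + s · v
·-distribʳ-⊕ (a , b , c) (d , e , f) (x , y , z) = poly a b c d e f x y z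
  where
  poly : ∀ a b c d e f x y z →
    (a + d) * x + (b + e) * y + (c + f) * z ≡ (a * x + b * y + c * z) + (d * x + e * y + f * z)
  poly = solve-∀

·-∙ : ∀ k r v → (k ∙ r) · v ≡ k * (r · v)
·-∙ k (a , b , c) (x , y , z) = poly k a b c x y z
  where
  poly : ∀ k a b c x y z → k * a * x + k * b * y + k * c * z ≡ k * (a * x + b * y + c * z)
  poly = solve-∀

trace minorSum det : Mat₃ → ℤ
trace ((a , _ , _) , (_ , e , _) , (_ , _ , i)) = a + e + i
minorSum ((a , b , c) , (d , e , f) , (g , h , i)) = (a * e - b * d) + (a * i - c * g) + (e * i - f * h)
det ((a , b , c) , (d , e , f) , (g , h , i)) = a * (e * i - f * h) - b * (d * i - f * g) + c * (d * h - e * g)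

cayley-hamilton : ∀ T v → head (T ⊛ (T ⊛ (T ⊛ v))) ≡
  trace T * head (T ⊛ (T ⊛ v)) + (- minorSum T) * head (T ⊛ v) + det T * head v
cayley-hamilton ((a , b , c) , (d , e , f) , (g , h , i)) (x , y , z) = poly a b c d e f g h i x y z
  where
  poly : ∀ a b c d e f g h i x y z →
    let x₁ = a * x + b * y + c * z
        y₁ = d * x + e * y + f * z
        z₁ = g * x + h * y + i * z
        x₂ = a * x₁ + b * y₁ + c * z₁
        y₂ = d * x₁ + e * y₁ + f * z₁
        z₂ = g * x₁ + h * y₁ + i * z₁
    in a * x₂ + b * y₂ + c * z₂ ≡
         (a + e + i) * x₂ + - ((a * e - b * d) + (a * i - c * g) + (e * i - f * h)) * x₁
         + (a * (e * i - f * h) - b * (d * i - f * g) + c * (d * h - e * g)) * x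
  poly = solve-∀

orbit-head : ∀ T {v₀ v₁ v₂ v₃} → v₁ ≡ T ⊛ v₀ → v₂ ≡ T ⊛ v₁ → v₃ ≡ T ⊛ v₂ →
  head v₃ ≡ trace T * head v₂ + (- minorSum T) * head v₁ + det T * head v₀
orbit-head T {v₀} refl refl refl = cayley-hamilton T v₀

module _ {I : Set} (basis : I → ℤ³) where

  Expressible : (I → ℤ) → Set
  Expressible u = ∃ λ r → ∀ i → u i ≡ r · basis i

  expressible-combination : ∀ s t d {u v w} → Expressible u → Expressible v → Expressible w →
    Expressible (λ i → s * u i + t * v i + d * w i)
  expressible-combination s t d {u} {v} {w} (r , u≡) (r′ , v≡) (r″ , w≡) =
    s ∙ r ⊕ t ∙ r′ ⊕ d ∙ r″ , λ i → sym (begin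
      (s ∙ r ⊕ t ∙ r′ ⊕ d ∙ r″) · basis i
        ≡⟨ ·-distribʳ-⊕ (s ∙ r ⊕ t ∙ r′) (d ∙ r″) (basis i) ⟩
      (s ∙ r ⊕ t ∙ r′) · basis i + (d ∙ r″) · basis i
        ≡⟨ cong (_+ _) (·-distribʳ-⊕ (s ∙ r) (t ∙ r′) (basis i)) ⟩
      (s ∙ r) · basis i + (t ∙ r′) · basis i + (d ∙ r″) · basis i
        ≡⟨ cong₂ _+_ (cong₂ _+_ (·-∙ s r (basis i)) (·-∙ t r′ (basis i))) (·-∙ d r″ (basis i)) ⟩
      s * (r · basis i) + t * (r′ · basis i) + d * (r″ · basis i)
        ≡⟨ sym (cong₂ _+_ (cong₂ _+_ (cong (s *_) (u≡ i)) (cong (t *_) (v≡ i))) (cong (d *_) (w≡ i))) ⟩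
      s * u i + t * v i + d * w i ∎)

  expressible-cong : ∀ {u v} → (∀ i → u i ≡ v i) → Expressible u → Expressible v
  expressible-cong u≡v (r , u≡) = r , λ i → trans (sym (u≡v i)) (u≡ i)

  expressible-proj₀ : Expressible (proj₁ ∘ basis)
  expressible-proj₀ = (+ 1 , + 0 , + 0) , λ i → unit (proj₁ (basis i)) (proj₁ (proj₂ (basis i))) (proj₂ (proj₂ (basis i)))
    where
    unit : ∀ x y z → x ≡ + 1 * x + + 0 * y + + 0 * z
    unit = solve-∀

  expressible-proj₁ : Expressible (proj₁ ∘ proj₂ ∘ basis)
  expressible-proj₁ = (+ 0 , + 1 , + 0) , λ i → unit (proj₁ (basis i)) (proj₁ (proj₂ (basis i))) (proj₂ (proj₂ (basis i)))
    where
    unit : ∀ x y z → y ≡ + 0 * x + + 1 * y + + 0 * z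
    unit = solve-∀

  expressible-proj₂ : Expressible (proj₂ ∘ proj₂ ∘ basis)
  expressible-proj₂ = (+ 0 , + 0 , + 1) , λ i → unit (proj₁ (basis i)) (proj₁ (proj₂ (basis i))) (proj₂ (proj₂ (basis i)))
    where
    unit : ∀ x y z → z ≡ + 0 * x + + 0 * y + + 1 * z
    unit = solve-∀

  expressible-everywhere : (F : ℤ → I → ℤ) (s t d s′ t′ d′ : ℤ) →
    (∀ e i → F (e + + 3) i ≡ s * F (e + + 2) i + t * F (e + + 1) i + d * F e i) →
    (∀ e i → F e i ≡ s′ * F (e + + 1) i + t′ * F (e + + 2) i + d′ * F (e + + 3) i) →
    Expressible (F (+ 0)) → Expressible (F (+ 1)) → Expressible (F (+ 2)) →
    ∀ e → Expressible (F e)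
  expressible-everywhere F s t d s′ t′ d′ forward backward E₀ E₁ E₂ =
    ℤ-ind₃ (Expressible ∘ F) E₀ E₁ E₂
      (λ e E₀ E₁ E₂ → expressible-cong (sym ∘ forward e) (expressible-combination s t d E₂ E₁ E₀))
      (λ e E₁ E₂ E₃ → expressible-cong (sym ∘ backward e) (expressible-combination s′ t′ d′ E₁ E₂ E₃))

window : ℤ → ℤ³
window n = P n , P (n + + 1) , P (n + + 2)

P-shifted-expressible : ∀ e → Expressible window (λ n → P (n + e))
P-shifted-expressible =
  expressible-everywhere window (λ e n → P (n + e)) (+ 0) (+ 1) (+ 1) (- + 1) (+ 0) (+ 1)
    (λ e n → trans (P-rec-at n e) (forward (P (n + (e + + 2))) (P (n + (e + + 1))) (P (n + e))))
    (λ e n → backward (P (n + (e + + 2))) (P (n + (e + + 1))) (P (n + e)) (P-rec-at n e))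
    (expressible-cong window (λ n → sym (cong P (+-identityʳ n))) (expressible-proj₀ window))
    (expressible-proj₁ window)
    (expressible-proj₂ window)
  where
  P-rec-at : ∀ n e → P (n + (e + + 3)) ≡ P (n + (e + + 1)) + P (n + e)
  P-rec-at n e rewrite sym (+-assoc n e (+ 3)) | sym (+-assoc n e (+ 1)) = P-rec (n + e)

  forward : ∀ w y z → y + z ≡ + 0 * w + + 1 * y + + 1 * z
  forward = solve-∀
  backward : ∀ w y z {x} → x ≡ y + z → z ≡ - + 1 * y + + 0 * w + + 1 * x
  backward w y z refl = poly w y z
    where
    poly : ∀ w y z → z ≡ - + 1 * y + + 0 * w + + 1 * (y + z)
    poly = solve-∀

window-shift : ∀ a → ∃ λ T → ∀ n → window (n + a) ≡ T ⊛ window n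
window-shift a = rows (P-shifted-expressible a) (P-shifted-expressible (a + + 1)) (P-shifted-expressible (a + + 2))
  where
  rows : Expressible window (λ n → P (n + a)) → Expressible window (λ n → P (n + (a + + 1))) →
         Expressible window (λ n → P (n + (a + + 2))) → ∃ λ T → ∀ n → window (n + a) ≡ T ⊛ window n
  rows (r₀ , E₀) (r₁ , E₁) (r₂ , E₂) = (r₀ , r₁ , r₂) , λ n →
    cong₂ _,_ (E₀ n) (cong₂ _,_ (trans (cong P (+-assoc n a (+ 1))) (E₁ n))
                                (trans (cong P (+-assoc n a (+ 2))) (E₂ n)))

orbit-recurrence : (w : ℤ → ℤ³) (T : Mat₃) → (∀ k → w (k + + 1) ≡ T ⊛ w k) → ∀ e →
  head (w (e + + 3)) ≡ trace T * head (w (e + + 2)) + (- minorSum T) * head (w (e + + 1)) + det T * head (w e)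
orbit-recurrence w T step e =
  orbit-head T (step e)
    (trans (cong w (sym (+-assoc e (+ 1) (+ 1)))) (step (e + + 1)))
    (trans (cong w (sym (+-assoc e (+ 2) (+ 1)))) (step (e + + 2)))

reverse-orbit-recurrence : (w : ℤ → ℤ³) (U : Mat₃) → (∀ k → w k ≡ U ⊛ w (k + + 1)) → ∀ e →
  head (w e) ≡ trace U * head (w (e + + 1)) + (- minorSum U) * head (w (e + + 2)) + det U * head (w (e + + 3))
reverse-orbit-recurrence w U step e =
  orbit-head U
    (trans (step (e + + 2)) (cong (λ k → U ⊛ w k) (+-assoc e (+ 2) (+ 1))))
    (trans (step (e + + 1)) (cong (λ k → U ⊛ w k) (+-assoc e (+ 1) (+ 1))))
    (step e)

progression-span : ∀ x a k → ∃ λ c₁ → ∃ λ c₂ → ∃ λ c₃ →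
  P (x + a * k) ≡ c₁ * P (x + a * + 2) + c₂ * P (x + a * + 1) + c₃ * P (x + a * + 0)
progression-span x a k = coefficients (span k)
  where
  f : ℤ → ℤ
  f i = P (x + a * i)

  w : ℤ → ℤ³
  w i = window (x + a * i)

  -- A constant family indexed by ⊤: "expressible" then means a fixed integer combination.
  initial : ⊤ → ℤ³
  initial _ = f (+ 2) , f (+ 1) , f (+ 0)

  forward : ∃ λ T → ∀ i → w (i + + 1) ≡ T ⊛ w i
  forward = let T , shift = window-shift a in
    T , λ i → trans (cong window (step-up i)) (shift (x + a * i))
    where
    step-up : ∀ i → x + a * (i + + 1) ≡ (x + a * i) + a
    step-up i = solve (x ∷ a ∷ i ∷ [])

  backward : ∃ λ U → ∀ i → w i ≡ U ⊛ w (i + + 1)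
  backward = let U , shift = window-shift (- a) in
    U , λ i → trans (cong window (step-down i)) (shift (x + a * (i + + 1)))
    where
    step-down : ∀ i → x + a * i ≡ (x + a * (i + + 1)) + - a
    step-down i = solve (x ∷ a ∷ i ∷ [])

  span : ∀ i → Expressible initial (λ _ → f i)
  span = let T , T-orbit = forward; U , U-orbit = backward in
    expressible-everywhere initial (λ i _ → f i)
      (trace T) (- minorSum T) (det T) (trace U) (- minorSum U) (det U)
      (λ e _ → orbit-recurrence w T T-orbit e)
      (λ e _ → reverse-orbit-recurrence w U U-orbit e)
      (expressible-proj₂ initial) (expressible-proj₁ initial) (expressible-proj₀ initial)

  coefficients : ∀ {i} → Expressible initial (λ _ → f i) → ∃ λ c₁ → ∃ λ c₂ → ∃ λ c₃ →
    f i ≡ c₁ * f (+ 2) + c₂ * f (+ 1) + c₃ * f (+ 0)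
  coefficients ((c₁ , c₂ , c₃) , E) = c₁ , c₂ , c₃ , E tt

mainTheorem7 : (a b m : ℤ) → + 0 ≤ m → + 1 ≤ b → b ≤ a → a < a * m + b →
    (j : ℤ) → + 0 ≤ j →
    ∃ λ c₁ → ∃ λ c₂ → ∃ λ c₃ →
      P (a * m + b) ≡ c₁ * P (a * (j + + 2) + b) + c₂ * P (a * (j + + 1) + b) + c₃ * P (a * j + b)
mainTheorem7 a b m _ _ _ _ j _ =
  let c₁ , c₂ , c₃ , span = progression-span x a (m - j) in
  c₁ , c₂ , c₃ , (begin
    P (a * m + b)        ≡⟨ cong P target ⟩
    P (x + a * (m - j))  ≡⟨ span ⟩
    c₁ * P (x + a * + 2) + c₂ * P (x + a * + 1) + c₃ * P (x + a * + 0)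
      ≡⟨ cong₂ _+_ (cong₂ (λ u v → c₁ * P u + c₂ * P v) term₂ term₁) (cong (λ u → c₃ * P u) term₀) ⟩
    c₁ * P (a * (j + + 2) + b) + c₂ * P (a * (j + + 1) + b) + c₃ * P (a * j + b) ∎)
  where
  x : ℤ
  x = a * j + b
  target : a * m + b ≡ (a * j + b) + a * (m - j)
  target = solve (a ∷ b ∷ m ∷ j ∷ [])
  term₂ : (a * j + b) + a * + 2 ≡ a * (j + + 2) + b
  term₂ = solve (a ∷ b ∷ j ∷ [])
  term₁ : (a * j + b) + a * + 1 ≡ a * (j + + 1) + b
  term₁ = solve (a ∷ b ∷ j ∷ [])
  term₀ : (a * j + b) + a * + 0 ≡ a * j + b
  term₀ = solve (a ∷ b ∷ j ∷ [])
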